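{- Let $G$ be a geodetic graph, $r$ a vertex of $G$, and $T$ the bearing tree of $G$ rooted at $r$, and suppose any two distinct stems of $T$ intersect only in $r$. Suppose $T$ has three stems $s_1,s_2,s_3$ such that there is a balk between $s_1$ and $s_2$ and a balk between $s_2$ and $s_3$. Then there is also a balk between $s_1$ and $s_3$. Moreover, two of these three balks lie in the same tier, and the third lies in a tier whose index is not larger than that tier.
   Context: A geodesic is a shortest path; $G$ is geodetic if between any two vertices there is exactly one geodesic. The bearing tree rooted at $r$ is the spanning tree obtained by breadth-first search from $r$ (for geodetic $G$ it is unique: each vertex $v\ne r$ is joined to the neighbour of $v$ on the unique geodesic from $r$); $d_T(r,v)=d_G(r,v)$. The $k$-th tier is the set of vertices at distance $k$ from $r$. A stem is a path in $T$ from $r$ to a leaf of $T$. A balk is an edge of $G$ with both endpoints in the same tier; a balk between stems $s,s'$ in tier $j$ joins the tier-$j$ vertex of $s$ to the tier-$j$ vertex of $s'$. -}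

module Defs where

open import Level using (0ℓ)
open import Data.Nat using (ℕ; suc; _≤_)
open import Data.Fin using (Fin)
open import Data.List using (List; []; _∷_; _++_; length; head; last)
open import Data.Maybe using (just)
open import Data.Product using (Σ; ∃; _×_)
open import Data.Sum using (_⊎_)
open import Data.List.Relation.Unary.Linked using (Linked)
open import Data.List.Relation.Unary.Unique.Propositional using (Unique)
open import Data.List.Membership.Propositional using (_∈_)
open import Relation.Binary.PropositionalEquality using (_≡_)
open import Relation.Nullary using (¬_)

record Graph (n : ℕ) : Set₁ where
  field
    Adj    : Fin n → Fin n → Set
    sym    : ∀ {u v} → Adj u v → Adj v u
    irrefl : ∀ {u} → ¬ Adj u u

module _ {n : ℕ} where

  IsWalk : (Fin n → Fin n → Set) → Fin n → Fin n → List (Fin n) → Set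
  IsWalk R u v xs = Linked R xs × head xs ≡ just u × last xs ≡ just v

  -- A geodesic: a shortest walk from u to v (length = number of vertices - 1).
  Geodesic : Graph n → Fin n → Fin n → List (Fin n) → Set
  Geodesic G u v xs =
    IsWalk (Graph.Adj G) u v xs ×
    (∀ ys → IsWalk (Graph.Adj G) u v ys → length xs ≤ length ys)

  Dist : Graph n → Fin n → Fin n → ℕ → Set
  Dist G u v k = ∃ λ xs → Geodesic G u v xs × length xs ≡ suc k

  Geodetic : Graph n → Set
  Geodetic G = ∀ u v →
    (∃ λ xs → Geodesic G u v xs) ×
    (∀ xs ys → Geodesic G u v xs → Geodesic G u v ys → xs ≡ ys)

  -- Bearing tree rooted at r: u is the parent of v (v ≠ r) iff u is the
  -- neighbour of v on the (unique) geodesic from r to v.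
  Parent : Graph n → Fin n → Fin n → Fin n → Set
  Parent G r u v = ¬ (v ≡ r) ×
    (∃ λ xs → Geodesic G r v xs × ∃ λ ys → xs ≡ ys ++ (u ∷ v ∷ []))

  TreeEdge : Graph n → Fin n → Fin n → Fin n → Set
  TreeEdge G r u v = Parent G r u v ⊎ Parent G r v u

  Leaf : Graph n → Fin n → Fin n → Set
  Leaf G r v = ∀ w → ¬ Parent G r v w

  Stem : Graph n → Fin n → List (Fin n) → Set
  Stem G r s = Unique s × ∃ λ ℓ → Leaf G r ℓ × IsWalk (TreeEdge G r) r ℓ s

  BalkIn : Graph n → Fin n → List (Fin n) → List (Fin n) → ℕ → Set
  BalkIn G r s s' j = ∃ λ x → ∃ λ y →
    x ∈ s × y ∈ s' × Dist G r x j × Dist G r y j × Graph.Adj G x y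

  StemsDisjoint : Graph n → Fin n → Set
  StemsDisjoint G r = ∀ s s' → Stem G r s → Stem G r s' → ¬ (s ≡ s') →
    ∀ x → x ∈ s → x ∈ s' → x ≡ r

{-# OPTIONS --safe #-}
module Submission where

-- Write tier v for d(r, v) and u ⋖ v when u is the parent of v.  In a geodetic graph every
-- v ≠ r has exactly one parent, so a stem is a ⋖-chain from r to a leaf and contains every
-- ancestor of its vertices.  The engine of the proof: two distinct paths of the same length
-- between two vertices cannot both be geodesics, so a strictly shorter path exists.
--
-- Two balks between the same two stems lie in the same tier: otherwise, from the lower end u
-- of the lower balk, two equally long paths reach the far end of the upper one, and the
-- shorter path this forces climbs monotonically, putting u on both stems; but only r is.
-- Given balks s₁–s₂ in tier t and s₂–s₃ in tier t′ ≥ t, the tier-one vertex c of s₁ reaches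
-- the s₃-end y of the second balk in tier y + 1 steps both through r and, avoiding r, along
-- the stems and across both balks.  A shorter path cannot climb monotonically (c would lie on
-- s₃), so it climbs, crosses a level edge from s₁ to s₃ and climbs again: a balk s₁–s₃ in a
-- tier at most t′.  Composing once more and using uniqueness of balk tiers decides which of
-- the three tiers coincide.

open import Defs
open import Data.Nat using (ℕ; zero; suc; _+_; _≤_; _<_; s≤s; _≤?_; _<?_)
open import Data.Nat.Properties hiding (_≟_)
open import Data.Fin using (Fin; _≟_)
open import Data.Fin.Properties using (any?)
open import Data.List using (List; []; _∷_; _++_; _∷ʳ_; [_]; length; head; last; allFin)
open import Data.List.Properties using (∷ʳ-injective; ++-assoc; ∷-injectiveˡ; ∷-injectiveʳ; ≡-dec)
open import Data.List.Membership.Propositional using (_∈_)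
open import Data.List.Membership.Propositional.Properties using (∈-allFin)
open import Data.List.Relation.Unary.Any using (here; there)
open import Data.List.Relation.Unary.All as All using (All; []; _∷_)
open import Data.List.Relation.Unary.AllPairs using ([]; _∷_)
open import Data.List.Relation.Unary.Linked as Linked using (Linked; []; [-]; _∷_)
open import Data.List.Relation.Unary.Unique.Propositional using (Unique)
open import Data.Maybe using (just)
open import Data.Product as Product using (Σ; ∃; ∃₂; _×_; _,_; proj₁; proj₂; ∃-syntax)
open import Data.Sum using (_⊎_; inj₁; inj₂)
open import Function using (_∘_)
open import Relation.Binary.Definitions using (tri<; tri≈; tri>)
open import Relation.Binary.PropositionalEquality
  using (_≡_; _≢_; refl; sym; trans; cong; cong₂; subst; subst₂; module ≡-Reasoning)
open import Relation.Nullary using (¬_; Dec; yes; no; contradiction)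

infixr 5 _◅_

data Path {A : Set} (R : A → A → Set) : A → A → ℕ → Set where
  ε   : ∀ {a} → Path R a a 0
  _◅_ : ∀ {a b c k} → R a b → Path R b c k → Path R a c (suc k)

module _ {A : Set} where

  private
    variable
      R S : A → A → Set
      a b c : A
      k l : ℕ

  infixr 5 _◅◅_
  infixl 6 _▻_

  targets : Path R a b k → List A
  targets ε = []
  targets (_◅_ {b = w} _ p) = w ∷ targets p

  vertices : Path R a b k → List A
  vertices {a = a} p = a ∷ targets p

  linked-vertices : (p : Path R a b k) → Linked R (vertices p)
  linked-vertices ε = [-]
  linked-vertices (e ◅ p) = e ∷ linked-vertices p

  last-vertices : (p : Path R a b k) → last (vertices p) ≡ just b
  last-vertices ε = refl
  last-vertices (e ◅ ε) = refl
  last-vertices (e ◅ f ◅ p) = last-vertices (f ◅ p)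

  length-vertices : (p : Path R a b k) → length (vertices p) ≡ suc k
  length-vertices ε = refl
  length-vertices (e ◅ p) = cong suc (length-vertices p)

  end∈vertices : (p : Path R a b k) → b ∈ vertices p
  end∈vertices ε = here refl
  end∈vertices (e ◅ p) = there (end∈vertices p)

  fromLinked : ∀ xs → Linked R xs → head xs ≡ just a → last xs ≡ just b →
               ∃[ k ] Σ (Path R a b k) λ p → vertices p ≡ xs
  fromLinked [] _ () _
  fromLinked (x ∷ []) _ refl refl = 0 , ε , refl
  fromLinked (x ∷ y ∷ ys) (e ∷ linked) refl end with fromLinked (y ∷ ys) linked refl end
  ... | k , p , refl = suc k , e ◅ p , refl

  Path₀⇒≡ : Path R a b 0 → a ≡ b
  Path₀⇒≡ ε = refl

  uncons : 0 < k → Path R a c k → ∃ λ b → R a b × ∃ (Path R b c)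
  uncons _ (e ◅ p) = _ , e , _ , p

  _▻_ : Path R a b k → R b c → Path R a c (suc k)
  ε ▻ e = e ◅ ε
  (f ◅ p) ▻ e = f ◅ (p ▻ e)

  unsnoc : Path R a c (suc k) → ∃ λ b → Path R a b k × R b c
  unsnoc (e ◅ ε) = _ , ε , e
  unsnoc (e ◅ f ◅ p) with unsnoc (f ◅ p)
  ... | b , q , g = b , e ◅ q , g

  vertices-▻ : (p : Path R a b k) (e : R b c) → vertices (p ▻ e) ≡ vertices p ∷ʳ c
  vertices-▻ ε e = refl
  vertices-▻ {a = a} (f ◅ p) e = cong (a ∷_) (vertices-▻ p e)

  vertices-init : (p : Path R a b k) → ∃ λ xs → vertices p ≡ xs ∷ʳ b
  vertices-init ε = [] , refl
  vertices-init {a = a} (e ◅ p) = Product.map (a ∷_) (cong (a ∷_)) (vertices-init p)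

  _◅◅_ : Path R a b k → Path R b c l → Path R a c (k + l)
  ε ◅◅ q = q
  (e ◅ p) ◅◅ q = e ◅ (p ◅◅ q)

  mapPath : (∀ {x y} → R x y → S x y) → Path R a b k → Path S a b k
  mapPath f ε = ε
  mapPath f (e ◅ p) = f e ◅ mapPath f p

  penultimate-injective : ∀ xs ys {x y x′ y′ : A} → xs ++ x ∷ y ∷ [] ≡ ys ++ x′ ∷ y′ ∷ [] → x ≡ x′
  penultimate-injective xs ys {x} {y} {x′} {y′} eq =
    proj₂ (∷ʳ-injective xs ys (proj₁ (∷ʳ-injective (xs ∷ʳ x) (ys ∷ʳ x′) snoc-form)))
    where
    snoc-form : xs ∷ʳ x ∷ʳ y ≡ ys ∷ʳ x′ ∷ʳ y′
    snoc-form = trans (++-assoc xs [ x ] [ y ]) (trans eq (sym (++-assoc ys [ x′ ] [ y′ ])))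

vertices-IsWalk : ∀ {n k} {R : Fin n → Fin n → Set} {a b : Fin n} (p : Path R a b k) →
                  IsWalk R a b (vertices p)
vertices-IsWalk p = linked-vertices p , refl , last-vertices p

module GeodeticGraph {n : ℕ} (G : Graph n) (geodetic : Geodetic G) where
  open Graph G

  private
    variable
      u v : Fin n
      k l : ℕ

    shortest : ∀ u v → ∃[ k ] Σ (Path Adj u v k) λ p → Geodesic G u v (vertices p)
    shortest u v with proj₁ (geodetic u v)
    ... | xs , g@((linked , first , final) , _) with fromLinked xs linked first final
    ... | k , p , refl = k , p , g

  dist : Fin n → Fin n → ℕ
  dist u v = proj₁ (shortest u v)

  dist-path : ∀ u v → Path Adj u v (dist u v)
  dist-path u v = proj₁ (proj₂ (shortest u v))

  dist-path-geodesic : ∀ u v → Geodesic G u v (vertices (dist-path u v))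
  dist-path-geodesic u v = proj₂ (proj₂ (shortest u v))

  geodesic-unique : ∀ {xs ys} → Geodesic G u v xs → Geodesic G u v ys → xs ≡ ys
  geodesic-unique {u} {v} = proj₂ (geodetic u v) _ _

  dist-≤ : Path Adj u v k → dist u v ≤ k
  dist-≤ {u} {v} p = ≤-pred (subst₂ _≤_ (length-vertices (dist-path u v)) (length-vertices p)
    (proj₂ (dist-path-geodesic u v) (vertices p) (vertices-IsWalk p)))

  ≤dist⇒geodesic : (p : Path Adj u v k) → k ≤ dist u v → Geodesic G u v (vertices p)
  ≤dist⇒geodesic {u} {v} {k} p k≤d = vertices-IsWalk p , λ ys walk → begin
    length (vertices p)                ≡⟨ length-vertices p ⟩
    suc k                              ≤⟨ s≤s k≤d ⟩
    suc (dist u v)                     ≡⟨ length-vertices (dist-path u v) ⟨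
    length (vertices (dist-path u v))  ≤⟨ proj₂ (dist-path-geodesic u v) ys walk ⟩
    length ys                          ∎
    where open ≤-Reasoning

  distinct-paths⇒shorter : (p : Path Adj u v k) (q : Path Adj u v l) → k ≡ l →
                           vertices p ≢ vertices q → dist u v < k
  distinct-paths⇒shorter {u} {v} {k} p q refl p≢q with dist u v <? k
  ... | yes d<k = d<k
  ... | no d≮k = contradiction
    (geodesic-unique (≤dist⇒geodesic p (≮⇒≥ d≮k)) (≤dist⇒geodesic q (≮⇒≥ d≮k))) p≢q

  Dist⇒≡dist : Dist G u v k → dist u v ≡ k
  Dist⇒≡dist {u} {v} {k} (xs , g , length-xs) = suc-injective (begin
    suc (dist u v)                     ≡⟨ length-vertices (dist-path u v) ⟨
    length (vertices (dist-path u v))  ≡⟨ cong length (geodesic-unique (dist-path-geodesic u v) g) ⟩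
    length xs                          ≡⟨ length-xs ⟩
    suc k                              ∎)
    where open ≡-Reasoning

  dist-Dist : ∀ u v → Dist G u v (dist u v)
  dist-Dist u v = vertices (dist-path u v) , dist-path-geodesic u v , length-vertices (dist-path u v)

module BearingTree {n : ℕ} (G : Graph n) (geodetic : Geodetic G) (r : Fin n) where
  open Graph G renaming (sym to Adj-sym)
  open GeodeticGraph G geodetic

  private
    variable
      u v w x : Fin n
      k l t t′ t″ : ℕ
      xs s s′ s₁ s₂ s₃ : List (Fin n)

  tier : Fin n → ℕ
  tier = dist r

  tier-root : tier r ≡ 0
  tier-root = n≤0⇒n≡0 (dist-≤ ε)

  tier≡0⇒root : tier v ≡ 0 → v ≡ r
  tier≡0⇒root {v} eq = sym (Path₀⇒≡ (subst (Path Adj r v) eq (dist-path r v)))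

  nonroot⇒tier>0 : v ≢ r → 0 < tier v
  nonroot⇒tier>0 v≢r = n≢0⇒n>0 (λ eq → v≢r (tier≡0⇒root eq))

  tier-adj : Adj u v → tier v ≤ suc (tier u)
  tier-adj {u} e = dist-≤ (dist-path r u ▻ e)

  tier-path : Path Adj u v k → tier v ≤ tier u + k
  tier-path {u} p = dist-≤ (dist-path r u ◅◅ p)

  level-edge-avoids-root : Adj u v → tier u ≡ tier v → u ≢ r
  level-edge-avoids-root {v = v} e eq refl =
    irrefl (subst (Adj r) (tier≡0⇒root (trans (sym eq) tier-root)) e)

  infix 4 _⋖_

  _⋖_ : Fin n → Fin n → Set
  u ⋖ v = Adj u v × tier v ≡ suc (tier u)

  ⋖-nonroot : u ⋖ v → v ≢ r
  ⋖-nonroot (_ , eq) refl = 0≢1+n (trans (sym tier-root) eq)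

  root⋖⇒tier≡1 : r ⋖ u → tier u ≡ 1
  root⋖⇒tier≡1 (_ , eq) = trans eq (cong suc tier-root)

  ⋖-geodesic : u ⋖ v → ∃ λ ys → Geodesic G r v (ys ++ u ∷ v ∷ [])
  ⋖-geodesic {u} {v} (e , eq) with vertices-init (dist-path r u)
  ... | ys , init = ys , subst (Geodesic G r v) split
                          (≤dist⇒geodesic (dist-path r u ▻ e) (≤-reflexive (sym eq)))
    where
    open ≡-Reasoning
    split : vertices (dist-path r u ▻ e) ≡ ys ++ u ∷ v ∷ []
    split = begin
      vertices (dist-path r u ▻ e)  ≡⟨ vertices-▻ (dist-path r u) e ⟩
      vertices (dist-path r u) ∷ʳ v ≡⟨ cong (_∷ʳ v) init ⟩
      ys ∷ʳ u ∷ʳ v                  ≡⟨ ++-assoc ys [ u ] [ v ] ⟩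
      ys ++ u ∷ v ∷ []              ∎

  ⋖-unique : u ⋖ w → v ⋖ w → u ≡ v
  ⋖-unique u⋖w v⋖w with ⋖-geodesic u⋖w | ⋖-geodesic v⋖w
  ... | ys , g | zs , h = penultimate-injective ys zs (geodesic-unique g h)

  parent-exists : v ≢ r → ∃ (_⋖ v)
  parent-exists {v} v≢r = last-step (tier v) refl (dist-path r v)
    where
    last-step : ∀ k → tier v ≡ k → Path Adj r v k → ∃ (_⋖ v)
    last-step zero eq _ = contradiction (tier≡0⇒root eq) v≢r
    last-step (suc k) eq p with unsnoc p
    ... | u , q , e = u , e , trans eq (cong suc tier-u)
      where
      tier-u : k ≡ tier u
      tier-u = ≤-antisym (≤-pred (subst (_≤ suc (tier u)) eq (tier-adj e))) (dist-≤ q)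

  Parent⇒⋖ : Parent G r u v → u ⋖ v
  Parent⇒⋖ (v≢r , _ , g , ys , refl) with parent-exists v≢r
  ... | w , w⋖v with ⋖-geodesic w⋖v
  ... | zs , h = subst (_⋖ _) (penultimate-injective zs ys (geodesic-unique h g)) w⋖v

  ⋖⇒Parent : u ⋖ v → Parent G r u v
  ⋖⇒Parent u⋖v with ⋖-geodesic u⋖v
  ... | ys , g = ⋖-nonroot u⋖v , _ , g , ys , refl

  _⋖?_ : ∀ u v → Dec (u ⋖ v)
  u ⋖? v with v ≟ r
  ... | yes refl = no (λ u⋖r → ⋖-nonroot u⋖r refl)
  ... | no v≢r with parent-exists v≢r
  ... | w , w⋖v with w ≟ u
  ... | yes refl = yes w⋖v
  ... | no w≢u = no (λ u⋖v → w≢u (⋖-unique w⋖v u⋖v))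

  Ascent : Fin n → Fin n → ℕ → Set
  Ascent = Path _⋖_

  ascent-tier : Ascent u v k → tier u + k ≡ tier v
  ascent-tier {u} ε = +-identityʳ (tier u)
  ascent-tier {u} {k = suc k} ((_ , eq) ◅ p) =
    trans (+-suc (tier u) k) (trans (cong (_+ k) (sym eq)) (ascent-tier p))

  ascent-above : (p : Ascent u v k) → All (λ z → tier u ≤ tier z) (vertices p)
  ascent-above ε = ≤-refl ∷ []
  ascent-above ((_ , eq) ◅ p) =
    ≤-refl ∷ All.map (λ le → ≤-trans (n≤1+n _) (≤-trans (≤-reflexive (sym eq)) le)) (ascent-above p)

  ascent-unique : (p : Ascent u v k) → Unique (vertices p)
  ascent-unique ε = [] ∷ []
  ascent-unique ((_ , eq) ◅ p) =
    All.map (λ { le refl → <-irrefl refl (subst (_≤ _) eq le) }) (ascent-above p) ∷ ascent-unique p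

  ascent-flat⇒≡ : Ascent u v k → tier v ≤ tier u → u ≡ v
  ascent-flat⇒≡ ε _ = refl
  ascent-flat⇒≡ {u} p@(_ ◅ _) le =
    contradiction (subst (_≤ tier u) (sym (ascent-tier p)) le) (m+1+n≰m (tier u))

  ascent-from-root : ∀ v → Ascent r v (tier v)
  ascent-from-root v = climb (tier v) refl
    where
    climb : ∀ k {v} → tier v ≡ k → Ascent r v k
    climb zero eq with tier≡0⇒root eq
    ... | refl = ε
    climb (suc k) {v} eq with parent-exists (λ { refl → 0≢1+n (trans (sym tier-root) eq) })
    ... | u , u⋖v = climb k (suc-injective (trans (sym (proj₂ u⋖v)) eq)) ▻ u⋖v

  tight-path⇒ascent : Path Adj u v k → tier u + k ≤ tier v → Ascent u v k
  tight-path⇒ascent ε _ = ε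
  tight-path⇒ascent {u} {v} {suc k} (_◅_ {b = w} e p) tight = (e , tier-w) ◅ tight-path⇒ascent p tight′
    where
    open ≤-Reasoning
    tier-w : tier w ≡ suc (tier u)
    tier-w = ≤-antisym (tier-adj e) (+-cancelʳ-≤ k _ _ (begin
      suc (tier u) + k  ≡⟨ +-suc (tier u) k ⟨
      tier u + suc k    ≤⟨ tight ⟩
      tier v            ≤⟨ tier-path p ⟩
      tier w + k        ∎))
    tight′ : tier w + k ≤ tier v
    tight′ = subst (_≤ tier v) (trans (+-suc (tier u) k) (cong (_+ k) (sym tier-w))) tight

  nearly-tight-path⇒level-edge : Path Adj u v k → tier u + k ≡ suc (tier v) →
    ∃₂ λ x y → ∃ (Ascent u x) × Adj x y × tier x ≡ tier y × ∃ (Ascent y v)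
  nearly-tight-path⇒level-edge {u} ε eq = contradiction (sym (trans (sym (+-identityʳ (tier u))) eq)) 1+n≢n
  nearly-tight-path⇒level-edge {u} {v} {suc k} (_◅_ {b = w} e p) eq with tier u <? tier w
  ... | yes u<w =
    let x , y , (_ , w→x) , rest = nearly-tight-path⇒level-edge p
                                     (trans (cong (_+ k) tier-w) (trans (sym (+-suc (tier u) k)) eq))
    in x , y , (_ , (e , tier-w) ◅ w→x) , rest
    where
    tier-w : tier w ≡ suc (tier u)
    tier-w = ≤-antisym (tier-adj e) u<w
  ... | no u≮w =
    u , w , (_ , ε) , e , flat , (_ , tight-path⇒ascent p (≤-reflexive (trans (cong (_+ k) (sym flat)) tier-v)))
    where
    tier-v : tier u + k ≡ tier v
    tier-v = suc-injective (trans (sym (+-suc (tier u) k)) eq)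
    flat : tier u ≡ tier w
    flat = ≤-antisym (+-cancelʳ-≤ k _ _ (≤-trans (≤-reflexive tier-v) (tier-path p))) (≮⇒≥ u≮w)

  ascending-walk : u ⋖ v → Linked (TreeEdge G r) (v ∷ xs) → Unique (u ∷ v ∷ xs) → Linked _⋖_ (v ∷ xs)
  ascending-walk {xs = []} _ _ _ = [-]
  ascending-walk {xs = y ∷ ys} _ (inj₁ v→y ∷ walk) (_ ∷ unique) =
    Parent⇒⋖ v→y ∷ ascending-walk (Parent⇒⋖ v→y) walk unique
  ascending-walk {xs = y ∷ ys} u⋖v (inj₂ y→v ∷ _) ((_ ∷ u≢y ∷ _) ∷ _) =
    contradiction (⋖-unique u⋖v (Parent⇒⋖ y→v)) u≢y

  stem-ascends : Stem G r s → ∃ λ xs → s ≡ r ∷ xs × Linked _⋖_ (r ∷ xs)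
  stem-ascends {[]} (_ , _ , _ , _ , () , _)
  stem-ascends {_ ∷ []} (_ , _ , _ , _ , refl , _) = [] , refl , [-]
  stem-ascends {_ ∷ y ∷ ys} (unique , _ , _ , inj₁ r→y ∷ walk , refl , _) =
    y ∷ ys , refl , Parent⇒⋖ r→y ∷ ascending-walk (Parent⇒⋖ r→y) walk unique
  stem-ascends {_ ∷ y ∷ ys} (_ , _ , _ , inj₂ (r≢r , _) ∷ _ , refl , _) = contradiction refl r≢r

  chain-ascent : Linked _⋖_ (u ∷ xs) → v ∈ u ∷ xs → ∃ (Ascent u v)
  chain-ascent _ (here refl) = _ , ε
  chain-ascent (u⋖w ∷ chain) (there v∈) = Product.map suc (u⋖w ◅_) (chain-ascent chain v∈)

  chain-comparable : Linked _⋖_ xs → u ∈ xs → v ∈ xs → ∃ (Ascent u v) ⊎ ∃ (Ascent v u)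
  chain-comparable chain (here refl) v∈ = inj₁ (chain-ascent chain v∈)
  chain-comparable chain (there u∈) (here refl) = inj₂ (chain-ascent chain (there u∈))
  chain-comparable chain (there u∈) (there v∈) = chain-comparable (Linked.tail chain) u∈ v∈

  chain-parent : Linked _⋖_ (w ∷ xs) → v ∈ xs → u ⋖ v → u ∈ w ∷ xs
  chain-parent (w⋖v ∷ _) (here refl) u⋖v = here (⋖-unique u⋖v w⋖v)
  chain-parent (_ ∷ chain) (there v∈) u⋖v = there (chain-parent chain v∈ u⋖v)

  root-chain-closed : Linked _⋖_ (r ∷ xs) → v ∈ r ∷ xs → Ascent u v k → u ∈ r ∷ xs
  root-chain-closed chain v∈ ε = v∈
  root-chain-closed chain v∈ (u⋖w ◅ p) with root-chain-closed chain v∈ p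
  ... | here refl = contradiction refl (⋖-nonroot u⋖w)
  ... | there w∈ = chain-parent chain w∈ u⋖w

  stem-closed : Stem G r s → v ∈ s → Ascent u v k → u ∈ s
  stem-closed stem v∈ p with stem-ascends stem
  ... | _ , refl , chain = root-chain-closed chain v∈ p

  stem-ordered : Stem G r s → u ∈ s → v ∈ s → tier u ≤ tier v → ∃ (Ascent u v)
  stem-ordered stem u∈ v∈ le with stem-ascends stem
  ... | _ , refl , chain with chain-comparable chain u∈ v∈
  ... | inj₁ up = up
  ... | inj₂ (_ , down) with ascent-flat⇒≡ down le
  ... | refl = _ , ε

  -- A termination measure for descending to a leaf: it strictly decreases along ⋖.
  #above : ℕ → List (Fin n) → ℕ
  #above t [] = 0
  #above t (w ∷ ws) with t <? tier w
  ... | yes _ = suc (#above t ws)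
  ... | no _ = #above t ws

  #above-antitone : ∀ ws → t ≤ t′ → #above t′ ws ≤ #above t ws
  #above-antitone [] le = ≤-refl
  #above-antitone {t} {t′} (w ∷ ws) le with t′ <? tier w | t <? tier w
  ... | yes _ | yes _ = s≤s (#above-antitone ws le)
  ... | yes t′<w | no t≮w = contradiction (≤-<-trans le t′<w) t≮w
  ... | no _ | yes _ = m≤n⇒m≤1+n (#above-antitone ws le)
  ... | no _ | no _ = #above-antitone ws le

  #above-drops : ∀ ws → v ∈ ws → tier v ≡ suc t → #above (suc t) ws < #above t ws
  #above-drops {t = t} (w ∷ ws) v∈ eq with suc t <? tier w | t <? tier w | v∈
  ... | yes t<w | _ | here refl = contradiction (sym eq) (<⇒≢ t<w)
  ... | no _ | yes _ | here refl = s≤s (#above-antitone ws (n≤1+n t))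
  ... | no _ | no t≮w | here refl = contradiction (≤-reflexive (sym eq)) t≮w
  ... | yes _ | yes _ | there v∈ws = s≤s (#above-drops ws v∈ws eq)
  ... | yes t<w | no t≮w | there _ = contradiction (<-trans (n<1+n t) t<w) t≮w
  ... | no _ | yes _ | there v∈ws = m≤n⇒m≤1+n (#above-drops ws v∈ws eq)
  ... | no _ | no _ | there v∈ws = #above-drops ws v∈ws eq

  leaf-above : ∀ x → ∃ λ ℓ → Leaf G r ℓ × ∃ (Ascent x ℓ)
  leaf-above x = descend _ x ≤-refl
    where
    descend : ∀ m x → #above (tier x) (allFin n) ≤ m → ∃ λ ℓ → Leaf G r ℓ × ∃ (Ascent x ℓ)
    descend m x bound with any? (x ⋖?_)
    ... | no childless = x , (λ c x→c → childless (c , Parent⇒⋖ x→c)) , _ , ε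
    ... | yes (c , x⋖c@(_ , eq)) with m | <-≤-trans (#above-drops (allFin n) (∈-allFin c) eq) bound
    ... | suc m | s≤s bound′ =
      let ℓ , leaf , c→ℓ = descend m c (subst (λ t → #above t (allFin n) ≤ m) (sym eq) bound′)
      in ℓ , leaf , Product.map suc (x⋖c ◅_) c→ℓ

  stem-through : ∀ x → ∃ λ s → Stem G r s × x ∈ s
  stem-through x with leaf-above x
  ... | ℓ , leaf , _ , x→ℓ = vertices p , stem , root-chain-closed chain (end∈vertices p) x→ℓ
    where
    p : Ascent r ℓ (tier ℓ)
    p = ascent-from-root ℓ
    chain : Linked _⋖_ (vertices p)
    chain = linked-vertices p
    stem : Stem G r (vertices p)
    stem = ascent-unique p , ℓ , leaf ,
           Linked.map (λ u⋖v → inj₁ (⋖⇒Parent u⋖v)) chain , refl , last-vertices p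

  Balk : List (Fin n) → List (Fin n) → ℕ → Set
  Balk s s′ t = ∃₂ λ x y → x ∈ s × y ∈ s′ × Adj x y × tier x ≡ t × tier y ≡ t

  BalkIn⇒Balk : BalkIn G r s s′ t → Balk s s′ t
  BalkIn⇒Balk (x , y , x∈ , y∈ , dx , dy , e) = x , y , x∈ , y∈ , e , Dist⇒≡dist dx , Dist⇒≡dist dy

  Balk⇒BalkIn : Balk s s′ t → BalkIn G r s s′ t
  Balk⇒BalkIn (x , y , x∈ , y∈ , e , refl , ty) =
    x , y , x∈ , y∈ , dist-Dist r x , subst (Dist G r y) ty (dist-Dist r y) , e

  balk-sym : Balk s s′ t → Balk s′ s t
  balk-sym (x , y , x∈ , y∈ , e , tx , ty) = y , x , y∈ , x∈ , Adj-sym e , ty , tx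

  module _ (disjoint : StemsDisjoint G r) where

    stems-meet-at-root : Stem G r s → Stem G r s′ → s ≢ s′ → u ∈ s → v ∈ s′ → Ascent u v k → u ≡ r
    stems-meet-at-root stem stem′ s≢s′ u∈ v∈ u→v =
      disjoint _ _ stem stem′ s≢s′ _ u∈ (stem-closed stem′ v∈ u→v)

    stem-descendant : Stem G r s → u ∈ s → u ≢ r → Ascent u v k → v ∈ s
    stem-descendant {s} {v = v} stem u∈ u≢r u→v with stem-through v
    ... | s′ , stem′ , v∈ with ≡-dec _≟_ s s′
    ... | yes refl = v∈
    ... | no s≢s′ = contradiction (stems-meet-at-root stem stem′ s≢s′ u∈ v∈ u→v) u≢r

    balks-not-stacked : Stem G r s → Stem G r s′ → s ≢ s′ → Balk s s′ t → Balk s s′ t′ → ¬ t < t′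
    balks-not-stacked stem stem′ s≢s′ (u , u′ , u∈ , u′∈ , e , refl , u′≡u)
                                      (w , w′ , w∈ , w′∈ , f , refl , w′≡w) u<w
      with stem-ordered stem u∈ w∈ (<⇒≤ u<w)
         | stem-ordered stem′ u′∈ w′∈ (subst₂ _≤_ (sym u′≡u) (sym w′≡w) (<⇒≤ u<w))
    ... | _ , ε | _ = <-irrefl refl u<w
    ... | suc k , u⋖c ◅ c→w | l , u′→w′ =
      level-edge-avoids-root e (sym u′≡u) (stems-meet-at-root stem stem′ s≢s′ u∈ w′∈ u→w′)
      where
      across : Path Adj u w′ (suc l)
      across = e ◅ mapPath proj₁ u′→w′
      along : Path Adj u w′ (suc (suc k))
      along = mapPath proj₁ (u⋖c ◅ c→w) ▻ f
      climb : tier u + l ≡ tier w′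
      climb = trans (cong (_+ l) (sym u′≡u)) (ascent-tier u′→w′)
      lengths : suc l ≡ suc (suc k)
      lengths = cong suc (+-cancelˡ-≡ (tier u) _ _
        (trans climb (trans w′≡w (sym (ascent-tier (u⋖c ◅ c→w))))))
      different : vertices across ≢ vertices along
      different eq = <-irrefl (cong tier (∷-injectiveˡ (∷-injectiveʳ eq)))
        (subst (_< tier _) (sym u′≡u) (≤-reflexive (sym (proj₂ u⋖c))))
      u→w′ : Ascent u w′ (dist u w′)
      u→w′ = tight-path⇒ascent (dist-path u w′)
        (≤-trans (+-monoʳ-≤ (tier u) (≤-pred (distinct-paths⇒shorter across along lengths different)))
                 (≤-reflexive climb))

    -- u cannot be an ancestor of v (it would lie on both stems), so a shortest path from u to v
    -- is one step too long for an ascent and leaves s by a level edge.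
    near-tier-one⇒balk : Stem G r s → Stem G r s′ → s ≢ s′ → r ⋖ u → u ∈ s → v ∈ s′ →
                         dist u v ≤ tier v → ∃ λ t → t ≤ tier v × Balk s s′ t
    near-tier-one⇒balk {u = u} {v} stem stem′ s≢s′ r⋖u u∈ v∈ near with m≤n⇒m<n∨m≡n near
    ... | inj₁ short = contradiction (stems-meet-at-root stem stem′ s≢s′ u∈ v∈ u→v) (⋖-nonroot r⋖u)
      where
      u→v : Ascent u v (dist u v)
      u→v = tight-path⇒ascent (dist-path u v)
              (subst (λ z → z + dist u v ≤ tier v) (sym (root⋖⇒tier≡1 r⋖u)) short)
    ... | inj₂ level
      with nearly-tight-path⇒level-edge (dist-path u v) (cong₂ _+_ (root⋖⇒tier≡1 r⋖u) level)
    ... | a , b , (_ , u→a) , g , flat , (m , b→v) =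
      tier b , subst (tier b ≤_) (ascent-tier b→v) (m≤m+n (tier b) m) ,
      a , b , stem-descendant stem u∈ (⋖-nonroot r⋖u) u→a , stem-closed stem′ v∈ b→v , g , flat , refl

    balk-compose : Stem G r s₁ → Stem G r s₂ → Stem G r s₃ → s₁ ≢ s₃ →
                   Balk s₁ s₂ t → Balk s₂ s₃ t′ → t ≤ t′ → ∃ λ t″ → t″ ≤ t′ × Balk s₁ s₃ t″
    balk-compose stem₁ stem₂ stem₃ s₁≢s₃ (x , x′ , x∈ , x′∈ , e , refl , x′≡x)
                                         (y , y′ , y∈ , y′∈ , f , refl , y′≡y) x≤y
      with uncons (nonroot⇒tier>0 (level-edge-avoids-root e (sym x′≡x))) (ascent-from-root x)
         | stem-ordered stem₂ x′∈ y∈ (subst (_≤ tier y) (sym x′≡x) x≤y)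
    ... | c , r⋖c , k , c→x | l , x′→y =
      Product.map₂ (Product.map₁ (λ le → ≤-trans le (≤-reflexive y′≡y)))
        (near-tier-one⇒balk stem₁ stem₃ s₁≢s₃ r⋖c (stem-closed stem₁ x∈ c→x) y′∈ (≤-pred shortcut))
      where
      open ≡-Reasoning
      through-root : Path Adj c y′ (suc (tier y′))
      through-root = Adj-sym (proj₁ r⋖c) ◅ dist-path r y′
      avoiding-root : Path Adj c y′ (k + suc (suc l))
      avoiding-root = mapPath proj₁ c→x ◅◅ e ◅ mapPath proj₁ x′→y ▻ f
      lengths : suc (tier y′) ≡ k + suc (suc l)
      lengths = sym (begin
        k + suc (suc l)    ≡⟨ +-suc k (suc l) ⟩
        suc (k + suc l)    ≡⟨ cong suc (+-suc k l) ⟩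
        suc (suc k + l)    ≡⟨ cong (λ z → suc (z + k + l)) (root⋖⇒tier≡1 r⋖c) ⟨
        suc (tier c + k + l) ≡⟨ cong (λ z → suc (z + l)) (ascent-tier c→x) ⟩
        suc (tier x + l)   ≡⟨ cong (λ z → suc (z + l)) x′≡x ⟨
        suc (tier x′ + l)  ≡⟨ cong suc (trans (ascent-tier x′→y) (sym y′≡y)) ⟩
        suc (tier y′)      ∎)
      different : ∀ {z k} (p : Ascent c z k) (g : Adj z x′) →
                  vertices through-root ≢ vertices (mapPath proj₁ p ◅◅ g ◅ mapPath proj₁ x′→y ▻ f)
      different ε _ eq = level-edge-avoids-root (Adj-sym e) x′≡x (sym (∷-injectiveˡ (∷-injectiveʳ eq)))
      different (c⋖d ◅ _) _ eq = ⋖-nonroot c⋖d (sym (∷-injectiveˡ (∷-injectiveʳ eq)))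
      shortcut : dist c y′ < suc (tier y′)
      shortcut = distinct-paths⇒shorter through-root avoiding-root lengths (different c→x e)

    balk-tier-unique : Stem G r s → Stem G r s′ → s ≢ s′ → Balk s s′ t → Balk s s′ t′ → t ≡ t′
    balk-tier-unique {t = t} {t′} stem stem′ s≢s′ b b′ with <-cmp t t′
    ... | tri< t<t′ _ _ = contradiction t<t′ (balks-not-stacked stem stem′ s≢s′ b b′)
    ... | tri≈ _ t≡t′ _ = t≡t′
    ... | tri> _ _ t′<t = contradiction t′<t (balks-not-stacked stem stem′ s≢s′ b′ b)

    -- Composing the new balk with the first one yields an s₂–s₃ balk, which must lie in tier t′.
    composed-balk-tier : Stem G r s₁ → Stem G r s₂ → Stem G r s₃ → s₂ ≢ s₃ →
                         Balk s₁ s₂ t → Balk s₂ s₃ t′ → Balk s₁ s₃ t″ → t < t′ → t″ ≤ t′ → t′ ≡ t″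
    composed-balk-tier {t = t} {t″ = t″} stem₁ stem₂ stem₃ s₂≢s₃ b₁₂ b₂₃ b₁₃ t<t′ t″≤t′ with t ≤? t″
    ... | yes t≤t″ =
      let τ , τ≤t″ , b₂₃′ = balk-compose stem₂ stem₁ stem₃ s₂≢s₃ (balk-sym b₁₂) b₁₃ t≤t″
          τ≡t′ = balk-tier-unique stem₂ stem₃ s₂≢s₃ b₂₃′ b₂₃
      in ≤-antisym (subst (_≤ t″) τ≡t′ τ≤t″) t″≤t′
    ... | no t≰t″ =
      let τ , τ≤t , b₃₂ = balk-compose stem₃ stem₁ stem₂ (s₂≢s₃ ∘ sym) (balk-sym b₁₃) b₁₂ (<⇒≤ (≰⇒> t≰t″))
          τ≡t′ = balk-tier-unique stem₂ stem₃ s₂≢s₃ (balk-sym b₃₂) b₂₃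
      in contradiction (subst (_≤ t) τ≡t′ τ≤t) (<⇒≱ t<t′)

    balk-triangle : Stem G r s₁ → Stem G r s₂ → Stem G r s₃ → s₁ ≢ s₂ → s₂ ≢ s₃ → s₁ ≢ s₃ →
                    Balk s₁ s₂ t → Balk s₂ s₃ t′ →
                    ∃ λ t″ → Balk s₁ s₃ t″ × ((t ≡ t′ × t″ ≤ t) ⊎ (t ≡ t″ × t′ ≤ t) ⊎ (t′ ≡ t″ × t ≤ t′))
    balk-triangle {t = t} {t′} stem₁ stem₂ stem₃ s₁≢s₂ s₂≢s₃ s₁≢s₃ b₁₂ b₂₃ with <-cmp t t′
    ... | tri≈ _ refl _ =
      let t″ , t″≤t , b₁₃ = balk-compose stem₁ stem₂ stem₃ s₁≢s₃ b₁₂ b₂₃ ≤-refl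
      in t″ , b₁₃ , inj₁ (refl , t″≤t)
    ... | tri< t<t′ _ _ =
      let t″ , t″≤t′ , b₁₃ = balk-compose stem₁ stem₂ stem₃ s₁≢s₃ b₁₂ b₂₃ (<⇒≤ t<t′)
      in t″ , b₁₃ , inj₂ (inj₂ (composed-balk-tier stem₁ stem₂ stem₃ s₂≢s₃ b₁₂ b₂₃ b₁₃ t<t′ t″≤t′ , <⇒≤ t<t′))
    ... | tri> _ _ t′<t =
      let t″ , t″≤t , b₃₁ = balk-compose stem₃ stem₂ stem₁ (s₁≢s₃ ∘ sym) (balk-sym b₂₃) (balk-sym b₁₂) (<⇒≤ t′<t)
          t≡t″ = composed-balk-tier stem₃ stem₂ stem₁ (s₁≢s₂ ∘ sym) (balk-sym b₂₃) (balk-sym b₁₂) b₃₁ t′<t t″≤t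
      in t″ , balk-sym b₃₁ , inj₂ (inj₁ (t≡t″ , <⇒≤ t′<t))

proposition2 : ∀ {n} (G : Graph n) (r : Fin n) → Geodetic G → StemsDisjoint G r →
    (s₁ s₂ s₃ : List (Fin n)) → Stem G r s₁ → Stem G r s₂ → Stem G r s₃ →
    ¬ (s₁ ≡ s₂) → ¬ (s₂ ≡ s₃) → ¬ (s₁ ≡ s₃) →
    (i j : ℕ) → BalkIn G r s₁ s₂ i → BalkIn G r s₂ s₃ j →
    ∃ λ k → BalkIn G r s₁ s₃ k ×
    ((i ≡ j × k ≤ i) ⊎ (i ≡ k × j ≤ i) ⊎ (j ≡ k × i ≤ j))
proposition2 G r geodetic disjoint _ _ _ stem₁ stem₂ stem₃ s₁≢s₂ s₂≢s₃ s₁≢s₃ _ _ b₁₂ b₂₃ =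
  let k , b₁₃ , tiers = balk-triangle disjoint stem₁ stem₂ stem₃ s₁≢s₂ s₂≢s₃ s₁≢s₃
                                      (BalkIn⇒Balk b₁₂) (BalkIn⇒Balk b₂₃)
  in k , Balk⇒BalkIn b₁₃ , tiers
  where open BearingTree G geodetic r
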